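{- Let $G=(V,E)$ be a subcubic graph and $K\subseteq V$ such that $G[K]$ is isomorphic to $K_{2,3}$. Let $G'$ be the graph obtained from $G$ by deleting the vertices of $K$ and introducing a new vertex $z$ adjacent to every vertex of $N(K)$. Then (i) $\alpha(G')=\alpha(G)-2$, and (ii) if $G'$ contains an induced apple with a long stem $A^*_p$, then $G$ also contains an induced apple with a long stem $A^*_{p'}$ for some $p'\ge p$.
   Context: Graphs are finite, simple, undirected; subcubic means maximum degree at most $3$; $\alpha$ is the independence number; $N(K)$ is the set of vertices outside $K$ having a neighbour in $K$. For $t\ge4$, the apple with a long stem $A^*_t$ is the graph formed by a chordless cycle on $t$ vertices, a stem vertex with exactly one neighbour on the cycle, and one further vertex adjacent only to the stem. -}

module Defs where

open import Data.Nat using (ℕ; zero; suc; _+_; _≤_; _<ᵇ_; _≡ᵇ_)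
open import Data.Bool using (Bool; true; false; if_then_else_; _∧_; _∨_; _xor_)
open import Data.Fin using (Fin; toℕ)
open import Data.Fin.Subset using (Subset; _∈_; ∣_∣)
open import Data.List using (map; allFin)
open import Data.Nat.ListAction using (sum)
open import Data.Product using (Σ; _×_; ∃)
open import Relation.Binary.PropositionalEquality using (_≡_)
open import Function.Definitions using (Injective)

record Graph (n : ℕ) : Set where
  field
    adj    : Fin n → Fin n → Bool
    sym    : ∀ u v → adj u v ≡ adj v u
    irrefl : ∀ v → adj v v ≡ false
open Graph public

degree : ∀ {n} → Graph n → Fin n → ℕ
degree {n} G v = sum (map (λ w → if adj G v w then 1 else 0) (allFin n))

Subcubic : ∀ {n} → Graph n → Set
Subcubic {n} G = ∀ (v : Fin n) → degree G v ≤ 3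

IsIndependent : ∀ {n} → Graph n → Subset n → Set
IsIndependent G S = ∀ u v → u ∈ S → v ∈ S → adj G u v ≡ false

IsIndependenceNumber : ∀ {n} → Graph n → ℕ → Set
IsIndependenceNumber {n} G k =
  (Σ (Subset n) λ S → IsIndependent G S × ∣ S ∣ ≡ k) ×
  (∀ (S : Subset n) → IsIndependent G S → ∣ S ∣ ≤ k)

-- K_{2,3} on Fin 5: parts {0,1} and {2,3,4}
k23Adj : Fin 5 → Fin 5 → Bool
k23Adj i j = (toℕ i <ᵇ 2) xor (toℕ j <ᵇ 2)

cycAdj : ℕ → ℕ → ℕ → Bool
cycAdj t i j = (suc i ≡ᵇ j) ∨ (suc j ≡ᵇ i) ∨ ((i ≡ᵇ 0) ∧ (suc j ≡ᵇ t)) ∨ ((j ≡ᵇ 0) ∧ (suc i ≡ᵇ t))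

-- The apple with a long stem A*_t on Fin (2 + t):
-- vertex 0 = the end vertex, vertex 1 = the stem, vertex 2+i = cycle vertex i (i < t);
-- the stem is adjacent to cycle vertex 0 only.
appleAdj : (t : ℕ) → Fin (2 + t) → Fin (2 + t) → Bool
appleAdj t i j = go (toℕ i) (toℕ j)
  where
  go : ℕ → ℕ → Bool
  go zero zero = false
  go zero (suc zero) = true
  go zero (suc (suc _)) = false
  go (suc zero) zero = true
  go (suc zero) (suc zero) = false
  go (suc zero) (suc (suc b)) = b ≡ᵇ 0
  go (suc (suc _)) zero = false
  go (suc (suc a)) (suc zero) = a ≡ᵇ 0
  go (suc (suc a)) (suc (suc b)) = cycAdj t a b

HasInducedApple : ∀ {n} → Graph n → ℕ → Set
HasInducedApple {n} G t =
  4 ≤ t ×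
  Σ (Fin (2 + t) → Fin n) λ h →
    Injective _≡_ _≡_ h × (∀ i j → adj G (h i) (h j) ≡ appleAdj t i j)

InducesK23 : ∀ {n} → Graph n → (Fin 5 → Fin n) → Set
InducesK23 G f = Injective _≡_ _≡_ f × (∀ i j → adj G (f i) (f j) ≡ k23Adj i j)

-- (i) A vertex on the side {0, 1} of K has degree 3 inside K, so it has no neighbour outside K;
-- a vertex on the side {2, 3, 4} has at most one, so N(K) is exactly the set of outside
-- neighbours of that side. An independent set S′ of G′ therefore gives one of G of size |S′| + 2:
-- drop z and add the side {2, 3, 4} if z ∈ S′, add the side {0, 1} otherwise. Conversely an
-- independent set I of G meets K inside one side, so in at most 2 vertices unless I contains the
-- whole side {2, 3, 4}; then I avoids N(K) and z can be added to I ∖ K.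
--
-- (ii) An induced A*_p of G′ avoiding z is one of G. If z is the end vertex, the neighbour of the
-- stem in {2, 3, 4} replaces it; if z is the stem, the neighbour in {2, 3, 4} of its foot on the
-- cycle becomes the stem and vertex 0 of K the end. If z lies on the cycle, it is replaced by the path
-- x – 0 – y, where x and y are the neighbours in {2, 3, 4} of the two cycle neighbours of z; this
-- lengthens the cycle by 2. When z is also the foot of the stem, the old stem becomes the end and its
-- neighbour in {2, 3, 4} the new stem, with foot 0.

module Submission where

open import Defs hiding (sym)
open import Data.Nat using (ℕ; zero; suc; _+_; _≤_; _<_; _∸_; z≤n; s≤s; _≡ᵇ_; _<ᵇ_; pred; >-nonZero)
open import Data.Nat.Properties
open import Data.Nat.ListAction using () renaming (sum to listSum)
open import Data.Bool using (Bool; true; false; if_then_else_; T; _∧_; _∨_; not)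
open import Data.Bool.Properties using (∨-comm; ∨-zeroʳ)
open import Data.Fin using (Fin; zero; suc; toℕ; fromℕ<; splitAt; _↑ˡ_; _↑ʳ_; join)
open import Data.Fin.Patterns using (0F; 1F; 2F; 3F; 4F)
open import Data.Fin.Properties using (splitAt-↑ˡ; splitAt-↑ʳ; join-splitAt; toℕ<n; toℕ-injective; toℕ-fromℕ<; any?)
  renaming (_≟_ to _≟ᶠ_)
open import Data.Fin.Permutation using (permutation)
open import Data.Fin.Subset using (Subset; _∈_; ∣_∣)
import Data.List as List
open import Data.List.Properties using (map-tabulate)
open import Data.Vec using ([]; _∷_; lookup; tabulate)
open import Data.Vec.Properties using (lookup∘tabulate; []=⇒lookup; lookup⇒[]=)
open import Data.Product using (Σ; _×_; ∃; _,_; proj₁; proj₂)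
open import Data.Sum using (_⊎_; inj₁; inj₂; [_,_])
import Data.Sum as Sum
open import Data.Sum.Function.Propositional using (_⊎-⇔_)
open import Data.Unit using (⊤; tt)
open import Data.Empty using (⊥; ⊥-elim)
open import Function using (_∘_; flip; case_of_)
open import Function.Bundles using (_⇔_; Equivalence; mk⇔)
open import Function.Construct.Symmetry using (⇔-sym)
open import Relation.Nullary using (¬_; yes; no)
open import Relation.Binary.PropositionalEquality hiding ([_])
open import Algebra.Properties.Monoid.Sum +-0-monoid using (sum; sum-syntax; sum-cong-≗)
open import Algebra.Properties.CommutativeMonoid.Sum +-0-commutativeMonoid using (sum-permute)
open import Algebra.Properties.CommutativeSemigroup +-commutativeSemigroup using (xy∙z≈xz∙y)

𝟙 : Bool → ℕ
𝟙 b = if b then 1 else 0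

𝟙≡0⇒≡false : ∀ {b} → 𝟙 b ≡ 0 → b ≡ false
𝟙≡0⇒≡false {false} _ = refl

≡ᵇ-true⇒≡ : ∀ {a b} → (a ≡ᵇ b) ≡ true → a ≡ b
≡ᵇ-true⇒≡ {a} {b} e = ≡ᵇ⇒≡ a b (subst T (sym e) _)

≡⇒≡ᵇ-true : ∀ {a b} → a ≡ b → (a ≡ᵇ b) ≡ true
≡⇒≡ᵇ-true {a} {b} e with a ≡ᵇ b in eq
... | true = refl
... | false = ⊥-elim (subst T eq (≡⇒≡ᵇ a b e))

≢⇒≡ᵇ-false : ∀ {a b} → a ≢ b → (a ≡ᵇ b) ≡ false
≢⇒≡ᵇ-false {a} {b} a≢b with a ≡ᵇ b in eq
... | false = refl
... | true = ⊥-elim (a≢b (≡ᵇ-true⇒≡ eq))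

∨-true⁻ : ∀ a {b} → a ∨ b ≡ true → a ≡ true ⊎ b ≡ true
∨-true⁻ true _ = inj₁ refl
∨-true⁻ false e = inj₂ e

∧-true⁻ : ∀ {a b} → a ∧ b ≡ true → a ≡ true × b ≡ true
∧-true⁻ {true} {true} _ = refl , refl

true≢false : true ≢ false
true≢false ()

≡-by-⇔true : ∀ {a b : Bool} → (a ≡ true → b ≡ true) → (b ≡ true → a ≡ true) → a ≡ b
≡-by-⇔true {true} to _ = sym (to refl)
≡-by-⇔true {false} {true} _ from = from refl
≡-by-⇔true {false} {false} _ _ = refl

¬true⇒≡false : ∀ {b : Bool} → (b ≡ true → ⊥) → b ≡ false
¬true⇒≡false {false} _ = refl
¬true⇒≡false {true} ¬b = ⊥-elim (¬b refl)

sum-map-allFin : ∀ {n} (φ : Fin n → ℕ) → listSum (List.map φ (List.allFin n)) ≡ sum φ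
sum-map-allFin {zero} φ = refl
sum-map-allFin {suc n} φ = cong (φ zero +_) (begin
  listSum (List.map φ (List.tabulate suc))     ≡⟨ cong listSum (map-tabulate suc φ) ⟩
  listSum (List.tabulate (φ ∘ suc))            ≡⟨ cong listSum (sym (map-tabulate (λ i → i) (φ ∘ suc))) ⟩
  listSum (List.map (φ ∘ suc) (List.allFin n)) ≡⟨ sum-map-allFin (φ ∘ suc) ⟩
  sum (φ ∘ suc)                                ∎)
  where open ≡-Reasoning

degree≡∑ : ∀ {n} (G : Graph n) v → degree G v ≡ ∑[ w < n ] 𝟙 (adj G v w)
degree≡∑ G v = sum-map-allFin (𝟙 ∘ adj G v)

∣S∣≡∑ : ∀ {n} (S : Subset n) → ∣ S ∣ ≡ ∑[ v < n ] 𝟙 (lookup S v)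
∣S∣≡∑ [] = refl
∣S∣≡∑ (true ∷ S) = cong suc (∣S∣≡∑ S)
∣S∣≡∑ (false ∷ S) = ∣S∣≡∑ S

∣tabulate∣≡∑ : ∀ {n} (χ : Fin n → Bool) → ∣ tabulate χ ∣ ≡ ∑[ v < n ] 𝟙 (χ v)
∣tabulate∣≡∑ χ = trans (∣S∣≡∑ (tabulate χ)) (sum-cong-≗ (cong 𝟙 ∘ lookup∘tabulate χ))

IsIndependent-tabulate : ∀ {n} (G : Graph n) (χ : Fin n → Bool) →
  (∀ {u v} → χ u ≡ true → χ v ≡ true → adj G u v ≡ false) → IsIndependent G (tabulate χ)
IsIndependent-tabulate G χ independent u v u∈ v∈ =
  independent (trans (sym (lookup∘tabulate χ u)) ([]=⇒lookup u∈)) (trans (sym (lookup∘tabulate χ v)) ([]=⇒lookup v∈))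

IsIndependent-lookup : ∀ {n} {G : Graph n} {S} → IsIndependent G S →
  ∀ {u v} → lookup S u ≡ true → lookup S v ≡ true → adj G u v ≡ false
IsIndependent-lookup {S = S} independent {u} {v} u∈ v∈ =
  independent u v (lookup⇒[]= u S u∈) (lookup⇒[]= v S v∈)

sum-splitAt : ∀ k {m} (φ : Fin (k + m) → ℕ) → sum φ ≡ sum (φ ∘ (_↑ˡ m)) + sum (φ ∘ (k ↑ʳ_))
sum-splitAt zero φ = refl
sum-splitAt (suc k) φ = trans (cong (φ zero +_) (sum-splitAt k (φ ∘ suc))) (sym (+-assoc (φ zero) _ _))

sum≤0⇒≡0 : ∀ {k} (φ : Fin k → ℕ) → sum φ ≤ 0 → ∀ i → φ i ≡ 0
sum≤0⇒≡0 φ le zero = n≤0⇒n≡0 (m+n≤o⇒m≤o (φ zero) le)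
sum≤0⇒≡0 φ le (suc i) = sum≤0⇒≡0 (φ ∘ suc) (m+n≤o⇒n≤o (φ zero) le) i

term≤sum : ∀ {k} (φ : Fin k → ℕ) i → φ i ≤ sum φ
term≤sum φ zero = m≤m+n _ _
term≤sum φ (suc i) = ≤-trans (term≤sum (φ ∘ suc) i) (m≤n+m _ (φ zero))

two-terms≤sum : ∀ {k} (φ : Fin k → ℕ) {i j} → i ≢ j → φ i + φ j ≤ sum φ
two-terms≤sum φ {zero} {zero} i≢j = ⊥-elim (i≢j refl)
two-terms≤sum φ {zero} {suc j} _ = +-monoʳ-≤ (φ zero) (term≤sum (φ ∘ suc) j)
two-terms≤sum φ {suc i} {zero} _ = subst (_≤ sum φ) (+-comm (φ zero) _) (+-monoʳ-≤ (φ zero) (term≤sum (φ ∘ suc) i))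
two-terms≤sum φ {suc i} {suc j} i≢j = ≤-trans (two-terms≤sum (φ ∘ suc) (i≢j ∘ cong suc)) (m≤n+m _ (φ zero))

module Partition {n k m : ℕ} (f : Fin k → Fin n) (g : Fin m → Fin n)
    (f-inj : ∀ a b → f a ≡ f b → a ≡ b) (g-inj : ∀ i j → g i ≡ g j → i ≡ j)
    (disjoint : ∀ i a → g i ≢ f a)
    (cover : ∀ v → (∃ λ a → f a ≡ v) ⊎ (∃ λ i → g i ≡ v)) where

  partition-elim : {P : Fin n → Set} → (∀ a → P (f a)) → (∀ i → P (g i)) → ∀ v → P v
  partition-elim Pf Pg v with cover v
  ... | inj₁ (a , refl) = Pf a
  ... | inj₂ (i , refl) = Pg i

  glue : {A : Set} → (Fin k → A) → (Fin m → A) → Fin n → A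
  glue φ ψ v = [ φ ∘ proj₁ , ψ ∘ proj₁ ] (cover v)

  glue-f : ∀ {A : Set} (φ : Fin k → A) (ψ : Fin m → A) a → glue φ ψ (f a) ≡ φ a
  glue-f φ ψ a with cover (f a)
  ... | inj₁ (a′ , e) = cong φ (f-inj _ _ e)
  ... | inj₂ (i , e) = ⊥-elim (disjoint i a e)

  glue-g : ∀ {A : Set} (φ : Fin k → A) (ψ : Fin m → A) i → glue φ ψ (g i) ≡ ψ i
  glue-g φ ψ i with cover (g i)
  ... | inj₁ (a , e) = ⊥-elim (disjoint i a (sym e))
  ... | inj₂ (i′ , e) = cong ψ (g-inj _ _ e)

  copair : Fin (k + m) → Fin n
  copair = [ f , g ] ∘ splitAt k

  uncopair : Fin n → Fin (k + m)
  uncopair = glue (_↑ˡ m) (k ↑ʳ_)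

  copair-uncopair : ∀ v → copair (uncopair v) ≡ v
  copair-uncopair = partition-elim
    (λ a → trans (cong copair (glue-f _ _ a)) (cong [ f , g ] (splitAt-↑ˡ k a m)))
    (λ i → trans (cong copair (glue-g _ _ i)) (cong [ f , g ] (splitAt-↑ʳ k m i)))

  uncopair-copair : ∀ x → uncopair (copair x) ≡ x
  uncopair-copair x = trans (uncopair-[f,g] (splitAt k x)) (join-splitAt k m x)
    where
    uncopair-[f,g] : ∀ s → uncopair ([ f , g ] s) ≡ join k m s
    uncopair-[f,g] (inj₁ a) = glue-f _ _ a
    uncopair-[f,g] (inj₂ i) = glue-g _ _ i

  sum-partition : ∀ (φ : Fin n → ℕ) → sum φ ≡ sum (φ ∘ f) + sum (φ ∘ g)
  sum-partition φ = begin
    sum φ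
      ≡⟨ sum-permute φ (permutation copair uncopair copair-uncopair uncopair-copair) ⟩
    sum (φ ∘ copair)
      ≡⟨ sum-splitAt k (φ ∘ copair) ⟩
    sum (φ ∘ copair ∘ (_↑ˡ m)) + sum (φ ∘ copair ∘ (k ↑ʳ_))
      ≡⟨ cong₂ _+_ (sum-cong-≗ (λ a → cong (φ ∘ [ f , g ]) (splitAt-↑ˡ k a m)))
                   (sum-cong-≗ (λ i → cong (φ ∘ [ f , g ]) (splitAt-↑ʳ k m i))) ⟩
    sum (φ ∘ f) + sum (φ ∘ g)
      ∎
    where open ≡-Reasoning

-- The cycle on 0 … t − 1

next : ℕ → ℕ → ℕ
next t q with suc q ≟ t
... | yes _ = 0
... | no _ = suc q

next-last : ∀ {t q} → suc q ≡ t → next t q ≡ 0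
next-last {t} {q} e with suc q ≟ t
... | yes _ = refl
... | no ne = ⊥-elim (ne e)

next-suc : ∀ {t q} → suc q ≢ t → next t q ≡ suc q
next-suc {t} {q} ne with suc q ≟ t
... | yes e = ⊥-elim (ne e)
... | no _ = refl

≡next : ∀ {t q q′} → q′ < t → suc q ≡ q′ → q′ ≡ next t q
≡next q′<t refl = sym (next-suc (<⇒≢ q′<t))

next< : ∀ {t q} → q < t → next t q < t
next< {t} {q} q<t with suc q ≟ t
... | yes _ = ≤-trans (s≤s z≤n) q<t
... | no ne = ≤∧≢⇒< q<t ne

next-injective : ∀ {t q q′} → next t q ≡ next t q′ → q ≡ q′
next-injective {t} {q} {q′} e with suc q ≟ t | suc q′ ≟ t
... | yes a | yes b = suc-injective (trans a (sym b))
... | yes _ | no _ = ⊥-elim (0≢1+n e)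
... | no _ | yes _ = ⊥-elim (0≢1+n (sym e))
... | no _ | no _ = suc-injective e

next≢ : ∀ {t q} → 2 ≤ t → q < t → next t q ≢ q
next≢ {t} {q} 2≤t _ e with suc q ≟ t
... | yes s = <⇒≢ 2≤t (sym (trans (sym s) (cong suc (sym e))))
... | no _ = 1+n≢n e

next²≢ : ∀ {t q} → 3 ≤ t → q < t → next t (next t q) ≢ q
next²≢ {t} {q} 3≤t q<t e with suc q ≟ t
... | yes s rewrite next-suc {t} {0} (<⇒≢ (≤-trans (s≤s (s≤s z≤n)) 3≤t)) =
  <⇒≢ 3≤t (sym (trans (sym s) (cong suc (sym e))))
... | no _ with suc (suc q) ≟ t
...   | yes s = <⇒≢ 3≤t (sym (trans (sym s) (cong (λ x → 2 + x) (sym e))))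
...   | no _ = <⇒≢ (≤-trans (n<1+n q) (n≤1+n _)) (sym e)

prev : ℕ → ℕ → ℕ
prev t zero = pred t
prev t (suc c) = c

next-prev : ∀ {t c} → c < t → next t (prev t c) ≡ c
next-prev {suc t} {zero} _ = next-last refl
next-prev {t} {suc c} c<t = next-suc (<⇒≢ c<t)

prev< : ∀ {t c} → c < t → prev t c < t
prev< {suc t} {zero} _ = n<1+n t
prev< {t} {suc c} c<t = <-trans (n<1+n c) c<t

CycleNeighbours : ℕ → ℕ → ℕ → Set
CycleNeighbours t q q′ = q′ ≡ next t q ⊎ q ≡ next t q′

cycAdj-sym : ∀ t a b → cycAdj t a b ≡ cycAdj t b a
cycAdj-sym t a b with suc a ≡ᵇ b | suc b ≡ᵇ a | (a ≡ᵇ 0) ∧ (suc b ≡ᵇ t) | (b ≡ᵇ 0) ∧ (suc a ≡ᵇ t)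
... | true | true | _ | _ = refl
... | true | false | _ | _ = refl
... | false | true | _ | _ = refl
... | false | false | x | y = ∨-comm x y

cycAdj-next : ∀ t q → cycAdj t q (next t q) ≡ true
cycAdj-next t q with suc q ≟ t
... | yes e rewrite ≡⇒≡ᵇ-true e = trans (cong ((1 ≡ᵇ q) ∨_) (∨-zeroʳ _)) (∨-zeroʳ _)
... | no _ rewrite ≡⇒≡ᵇ-true {q} refl = refl

CycleNeighbours⇒cycAdj : ∀ {t q q′} → CycleNeighbours t q q′ → cycAdj t q q′ ≡ true
CycleNeighbours⇒cycAdj {t} {q} (inj₁ refl) = cycAdj-next t q
CycleNeighbours⇒cycAdj {t} {q′ = q′} (inj₂ refl) = trans (cycAdj-sym t _ q′) (cycAdj-next t q′)

cycAdj⇒CycleNeighbours : ∀ {t q q′} → q < t → q′ < t → cycAdj t q q′ ≡ true → CycleNeighbours t q q′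
cycAdj⇒CycleNeighbours {t} {q} {q′} q<t q′<t e with ∨-true⁻ (suc q ≡ᵇ q′) e
... | inj₁ a = inj₁ (≡next q′<t (≡ᵇ-true⇒≡ a))
... | inj₂ e₂ with ∨-true⁻ (suc q′ ≡ᵇ q) e₂
...   | inj₁ b = inj₂ (≡next q<t (≡ᵇ-true⇒≡ b))
...   | inj₂ e₃ with ∨-true⁻ ((q ≡ᵇ 0) ∧ (suc q′ ≡ᵇ t)) e₃
...     | inj₁ c = let (c₁ , c₂) = ∧-true⁻ c in inj₂ (trans (≡ᵇ-true⇒≡ c₁) (sym (next-last (≡ᵇ-true⇒≡ c₂))))
...     | inj₂ d = let (d₁ , d₂) = ∧-true⁻ d in inj₁ (trans (≡ᵇ-true⇒≡ d₁) (sym (next-last (≡ᵇ-true⇒≡ d₂))))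

cycAdj-rotate : ∀ {t q q′} → q < t → q′ < t → cycAdj t (next t q) (next t q′) ≡ cycAdj t q q′
cycAdj-rotate {t} {q} {q′} q<t q′<t = ≡-by-⇔true to from
  where
  to : cycAdj t (next t q) (next t q′) ≡ true → cycAdj t q q′ ≡ true
  to e with cycAdj⇒CycleNeighbours (next< q<t) (next< q′<t) e
  ... | inj₁ a = CycleNeighbours⇒cycAdj (inj₁ (next-injective a))
  ... | inj₂ b = CycleNeighbours⇒cycAdj (inj₂ (next-injective b))
  from : cycAdj t q q′ ≡ true → cycAdj t (next t q) (next t q′) ≡ true
  from e with cycAdj⇒CycleNeighbours q<t q′<t e
  ... | inj₁ a = CycleNeighbours⇒cycAdj (inj₁ (cong (next t) a))
  ... | inj₂ b = CycleNeighbours⇒cycAdj (inj₂ (cong (next t) b))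

-- Slots of the cycle on 0 … t + 1 obtained from the cycle on 0 … t − 1 by
-- replacing its vertex c with a path left – apex – right.
data Slot : Set where
  old : ℕ → Slot
  left apex right : Slot

old-injective : ∀ {a b} → old a ≡ old b → a ≡ b
old-injective refl = refl

sucᵒ : Slot → Slot
sucᵒ (old r) = old (suc r)
sucᵒ s = s

splice : ℕ → ℕ → Slot
splice zero zero = left
splice zero (suc zero) = apex
splice zero (suc (suc zero)) = right
splice zero (suc (suc (suc d))) = old (suc d)
splice (suc c) zero = old 0
splice (suc c) (suc q) = sucᵒ (splice c q)

splice-below : ∀ {c q} → q < c → splice c q ≡ old q
splice-below {suc c} {zero} _ = refl
splice-below {suc c} {suc q} (s≤s q<c) rewrite splice-below q<c = refl

splice-left : ∀ c → splice c c ≡ left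
splice-left zero = refl
splice-left (suc c) rewrite splice-left c = refl

splice-apex : ∀ c → splice c (1 + c) ≡ apex
splice-apex zero = refl
splice-apex (suc c) rewrite splice-apex c = refl

splice-right : ∀ c → splice c (2 + c) ≡ right
splice-right zero = refl
splice-right (suc c) rewrite splice-right c = refl

splice-above : ∀ c d → splice c (3 + c + d) ≡ old (1 + c + d)
splice-above zero d = refl
splice-above (suc c) d rewrite splice-above c d = refl

data SplicePosition (c q : ℕ) : Set where
  below : q < c → SplicePosition c q
  at-left : q ≡ c → SplicePosition c q
  at-apex : q ≡ 1 + c → SplicePosition c q
  at-right : q ≡ 2 + c → SplicePosition c q
  above : ∀ d → q ≡ 3 + c + d → SplicePosition c q

splicePosition : ∀ c q → SplicePosition c q
splicePosition zero zero = at-left refl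
splicePosition zero (suc zero) = at-apex refl
splicePosition zero (suc (suc zero)) = at-right refl
splicePosition zero (suc (suc (suc d))) = above d refl
splicePosition (suc c) zero = below (s≤s z≤n)
splicePosition (suc c) (suc q) with splicePosition c q
... | below q<c = below (s≤s q<c)
... | at-left e = at-left (cong suc e)
... | at-apex e = at-apex (cong suc e)
... | at-right e = at-right (cong suc e)
... | above d e = above d (cong suc e)

unsplice : ℕ → Slot → ℕ
unsplice c (old r) with r <? c
... | yes _ = r
... | no _ = 2 + r
unsplice c left = c
unsplice c apex = 1 + c
unsplice c right = 2 + c

unsplice-splice : ∀ c q → unsplice c (splice c q) ≡ q
unsplice-splice c q with splicePosition c q
... | below q<c rewrite splice-below q<c with q <? c
...   | yes _ = refl
...   | no q≮c = ⊥-elim (q≮c q<c)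
unsplice-splice c q | at-left refl rewrite splice-left c = refl
unsplice-splice c q | at-apex refl rewrite splice-apex c = refl
unsplice-splice c q | at-right refl rewrite splice-right c = refl
unsplice-splice c q | above d refl rewrite splice-above c d with suc c + d <? c
...   | yes lt = ⊥-elim (<-asym lt (s≤s (m≤m+n c d)))
...   | no _ = refl

splice-injective : ∀ c {q q′} → splice c q ≡ splice c q′ → q ≡ q′
splice-injective c {q} {q′} e =
  trans (sym (unsplice-splice c q)) (trans (cong (unsplice c) e) (unsplice-splice c q′))

ValidSlot : ℕ → ℕ → Slot → Set
ValidSlot t c (old r) = r < t × r ≢ c
ValidSlot t c _ = ⊤

splice-valid : ∀ {t c q} → c < t → q < 2 + t → ValidSlot t c (splice c q)
splice-valid {t} {c} {q} c<t q<2+t with splicePosition c q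
... | below q<c rewrite splice-below q<c = <-trans q<c c<t , <⇒≢ q<c
... | at-left refl rewrite splice-left c = tt
... | at-apex refl rewrite splice-apex c = tt
... | at-right refl rewrite splice-right c = tt
... | above d refl rewrite splice-above c d = ≤-pred (≤-pred q<2+t) , λ e → <⇒≢ (s≤s (m≤m+n c d)) (sym e)

slotNext : ℕ → ℕ → Slot → Slot
slotNext t c (old r) = if r ≡ᵇ prev t c then left else old (next t r)
slotNext t c left = apex
slotNext t c apex = right
slotNext t c right = old (next t c)

slotNext-prev : ∀ t c → slotNext t c (old (prev t c)) ≡ left
slotNext-prev t c rewrite ≡⇒≡ᵇ-true {prev t c} refl = refl

slotNext-old : ∀ {t c r} → r ≢ prev t c → slotNext t c (old r) ≡ old (next t r)
slotNext-old r≢prev rewrite ≢⇒≡ᵇ-false r≢prev = refl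

slotNext-old-cases : ∀ t c r → (r ≡ prev t c × slotNext t c (old r) ≡ left) ⊎ slotNext t c (old r) ≡ old (next t r)
slotNext-old-cases t c r with r ≟ prev t c
... | yes refl = inj₁ (refl , slotNext-prev t c)
... | no r≢prev = inj₂ (slotNext-old {t} {c} r≢prev)

left≡slotNext⇒prev : ∀ {t c r} → left ≡ slotNext t c (old r) → r ≡ prev t c
left≡slotNext⇒prev {t} {c} {r} e with slotNext-old-cases t c r
... | inj₁ (r≡prev , _) = r≡prev
... | inj₂ e′ with () ← trans e e′

apex≢slotNext-old : ∀ {t c r} → apex ≢ slotNext t c (old r)
apex≢slotNext-old {t} {c} {r} e with slotNext-old-cases t c r
... | inj₁ (_ , e′) with () ← trans e e′
... | inj₂ e′ with () ← trans e e′

right≢slotNext-old : ∀ {t c r} → right ≢ slotNext t c (old r)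
right≢slotNext-old {t} {c} {r} e with slotNext-old-cases t c r
... | inj₁ (_ , e′) with () ← trans e e′
... | inj₂ e′ with () ← trans e e′

old≡slotNext-old⇔ : ∀ {t c r r′} → c < t → r′ ≢ c → (old r′ ≡ slotNext t c (old r)) ⇔ (r′ ≡ next t r)
old≡slotNext-old⇔ {t} {c} {r} {r′} c<t r′≢c with slotNext-old-cases t c r
... | inj₁ (refl , e) = mk⇔ (λ e′ → case trans e′ e of λ ()) (λ e′ → ⊥-elim (r′≢c (trans e′ (next-prev c<t))))
... | inj₂ e = mk⇔ (λ e′ → old-injective (trans e′ e)) (λ e′ → trans (cong old e′) (sym e))

SlotNeighbours : ℕ → ℕ → Slot → Slot → Set
SlotNeighbours t c a b = b ≡ slotNext t c a ⊎ a ≡ slotNext t c b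

CycleNeighbours⇔SlotNeighbours : ∀ {t c r r′} → c < t → r ≢ c → r′ ≢ c →
  CycleNeighbours t r r′ ⇔ SlotNeighbours t c (old r) (old r′)
CycleNeighbours⇔SlotNeighbours c<t r≢c r′≢c =
  ⇔-sym (old≡slotNext-old⇔ c<t r′≢c) ⊎-⇔ ⇔-sym (old≡slotNext-old⇔ c<t r≢c)

private
  suc≢2+ : ∀ {a t} → a ≤ t → suc a ≢ 2 + t
  suc≢2+ a≤t = <⇒≢ (s≤s (s≤s a≤t))

≢prev : ∀ {t c r} → 0 < t → c < r → suc r ≢ t → r ≢ prev t c
≢prev {t} {zero} 0<t _ sr≢t r≡prev = sr≢t (trans (cong suc r≡prev) (suc-pred t {{>-nonZero 0<t}}))
≢prev {t} {suc c₀} _ c<r _ r≡prev = <⇒≢ (<-trans (n<1+n c₀) c<r) (sym r≡prev)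

splice-next-below : ∀ {t c q} → c < t → q < c → splice c (suc q) ≡ slotNext t c (old q)
splice-next-below {t} {c} {q} c<t q<c with suc q ≟ c
... | yes refl = trans (splice-left c) (sym (slotNext-prev t c))
... | no sq≢c = trans (splice-below (≤∧≢⇒< q<c sq≢c)) (sym (trans (slotNext-old {t} {c} q≢prev) (cong old next-q)))
  where
  next-q : next t q ≡ suc q
  next-q = next-suc (<⇒≢ (≤-<-trans q<c c<t))
  q≢prev : q ≢ prev t c
  q≢prev e = sq≢c (trans (sym next-q) (trans (cong (next t) e) (next-prev c<t)))

splice-next-right : ∀ {t c} → 2 ≤ t → splice c (next (2 + t) (2 + c)) ≡ old (next t c)
splice-next-right {t} {c} 2≤t with suc c ≟ t
... | yes e rewrite next-last {2 + t} {2 + c} (cong (2 +_) e) = splice-below (0<c 2≤t e)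
  where
  0<c : ∀ {c t} → 2 ≤ t → suc c ≡ t → 0 < c
  0<c {zero} 2≤t refl = ⊥-elim (<⇒≢ 2≤t refl)
  0<c {suc _} _ _ = s≤s z≤n
... | no ne rewrite next-suc {2 + t} {2 + c} (ne ∘ suc-injective ∘ suc-injective) =
  trans (cong (splice c) (cong (3 +_) (sym (+-identityʳ c))))
        (trans (splice-above c 0) (cong (old ∘ suc) (+-identityʳ c)))

splice-next-above : ∀ {t c} → 2 ≤ t → ∀ d → splice c (next (2 + t) (3 + c + d)) ≡ slotNext t c (old (1 + c + d))
splice-next-above {t} {c} 2≤t d with 2 + c + d ≟ t
... | yes e rewrite next-last {2 + t} {3 + c + d} (cong (2 +_) e) with c
...   | zero rewrite ≡⇒≡ᵇ-true (cong pred e) = refl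
...   | suc c₀ rewrite ≢⇒≡ᵇ-false (<⇒≢ (<-trans (n<1+n c₀) (s≤s (m≤m+n (suc c₀) d))) ∘ sym) = refl
splice-next-above {t} {c} 2≤t d | no ne
  rewrite next-suc {2 + t} {3 + c + d} (ne ∘ suc-injective ∘ suc-injective)
        | ≢⇒≡ᵇ-false (≢prev {t} {c} (≤-trans (s≤s z≤n) 2≤t) (s≤s (m≤m+n c d)) ne) =
  trans (cong (splice c) (sym (+-suc (3 + c) d))) (trans (splice-above c (suc d)) (cong old (+-suc (suc c) d)))

splice-next : ∀ {t c q} → 2 ≤ t → c < t → q < 2 + t → splice c (next (2 + t) q) ≡ slotNext t c (splice c q)
splice-next {t} {c} {q} 2≤t c<t q<2+t with splicePosition c q
... | below q<c rewrite splice-below q<c | next-suc {2 + t} {q} (suc≢2+ (≤-trans (<⇒≤ q<c) (<⇒≤ c<t))) =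
  splice-next-below c<t q<c
... | at-left refl rewrite splice-left c | next-suc {2 + t} {c} (suc≢2+ (<⇒≤ c<t)) = splice-apex c
... | at-apex refl rewrite splice-apex c | next-suc {2 + t} {suc c} (suc≢2+ c<t) = splice-right c
... | at-right refl rewrite splice-right c = splice-next-right 2≤t
... | above d refl rewrite splice-above c d = splice-next-above 2≤t d

-- Induced cycles and apples

record InducedCycle {N} (G : Graph N) (t : ℕ) (rim : ℕ → Fin N) : Set where
  field
    adj-rim : ∀ {a b} → a < t → b < t → adj G (rim a) (rim b) ≡ cycAdj t a b
    rim-injective : ∀ {a b} → a < t → b < t → rim a ≡ rim b → a ≡ b

-- An induced A*_t with named vertices; rim 0 is the foot of the stem.
record Apple {N} (G : Graph N) (t : ℕ) : Set where
  field
    end stem : Fin N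
    rim : ℕ → Fin N
    cycle : InducedCycle G t rim
    end-stem : adj G end stem ≡ true
    end-rim : ∀ {a} → a < t → adj G end (rim a) ≡ false
    stem-rim : ∀ {a} → a < t → adj G stem (rim a) ≡ (a ≡ᵇ 0)
    end≢stem : end ≢ stem
    end∉rim : ∀ {a} → a < t → end ≢ rim a
    stem∉rim : ∀ {a} → a < t → stem ≢ rim a
  open InducedCycle cycle public

Apple⇒HasInducedApple : ∀ {N} {G : Graph N} {t} → 4 ≤ t → Apple G t → HasInducedApple G t
Apple⇒HasInducedApple {G = G} {t} 4≤t A = 4≤t , h , h-injective , h-adj
  where
  open Apple A
  h : Fin (2 + t) → Fin _
  h zero = end
  h (suc zero) = stem
  h (suc (suc i)) = rim (toℕ i)

  h-injective : ∀ {i j} → h i ≡ h j → i ≡ j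
  h-injective {zero} {zero} _ = refl
  h-injective {zero} {suc zero} e = ⊥-elim (end≢stem e)
  h-injective {zero} {suc (suc j)} e = ⊥-elim (end∉rim (toℕ<n j) e)
  h-injective {suc zero} {zero} e = ⊥-elim (end≢stem (sym e))
  h-injective {suc zero} {suc zero} _ = refl
  h-injective {suc zero} {suc (suc j)} e = ⊥-elim (stem∉rim (toℕ<n j) e)
  h-injective {suc (suc i)} {zero} e = ⊥-elim (end∉rim (toℕ<n i) (sym e))
  h-injective {suc (suc i)} {suc zero} e = ⊥-elim (stem∉rim (toℕ<n i) (sym e))
  h-injective {suc (suc i)} {suc (suc j)} e = cong (λ i → suc (suc i)) (toℕ-injective (rim-injective (toℕ<n i) (toℕ<n j) e))

  h-adj : ∀ i j → adj G (h i) (h j) ≡ appleAdj t i j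
  h-adj zero zero = irrefl G end
  h-adj zero (suc zero) = end-stem
  h-adj zero (suc (suc j)) = end-rim (toℕ<n j)
  h-adj (suc zero) zero = trans (Graph.sym G stem end) end-stem
  h-adj (suc zero) (suc zero) = irrefl G stem
  h-adj (suc zero) (suc (suc j)) = stem-rim (toℕ<n j)
  h-adj (suc (suc i)) zero = trans (Graph.sym G _ end) (end-rim (toℕ<n i))
  h-adj (suc (suc i)) (suc zero) = trans (Graph.sym G _ stem) (stem-rim (toℕ<n i))
  h-adj (suc (suc i)) (suc (suc j)) = adj-rim (toℕ<n i) (toℕ<n j)

atℕ : ∀ {k} {A : Set} → A → (Fin k → A) → ℕ → A
atℕ {zero} d v a = d
atℕ {suc k} d v zero = v zero
atℕ {suc k} d v (suc a) = atℕ d (v ∘ suc) a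

atℕ-fromℕ< : ∀ {k} {A : Set} (d : A) (v : Fin k → A) {a} (a<k : a < k) → atℕ d v a ≡ v (fromℕ< a<k)
atℕ-fromℕ< {suc k} d v {zero} _ = refl
atℕ-fromℕ< {suc k} d v {suc a} (s≤s a<k) = atℕ-fromℕ< d (v ∘ suc) a<k

HasInducedApple⇒Apple : ∀ {N} {G : Graph N} {t} → HasInducedApple G t → Apple G t
HasInducedApple⇒Apple {G = G} {t} (_ , h , h-injective , h-adj) = record
  { end = h zero
  ; stem = h (suc zero)
  ; rim = rim
  ; cycle = record { adj-rim = adj-rim ; rim-injective = rim-injective }
  ; end-stem = h-adj zero (suc zero)
  ; end-rim = λ a<t → trans (cong (adj G _) (rim≡ a<t)) (h-adj zero _)
  ; stem-rim = λ a<t → trans (cong (adj G _) (rim≡ a<t)) (trans (h-adj (suc zero) _) (cong (_≡ᵇ 0) (toℕ-fromℕ< a<t)))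
  ; end≢stem = λ e → 0≢1+n (cong toℕ (h-injective e))
  ; end∉rim = λ a<t e → 0≢1+n (cong toℕ (h-injective (trans e (rim≡ a<t))))
  ; stem∉rim = λ a<t e → 0≢1+n (suc-injective (cong toℕ (h-injective (trans e (rim≡ a<t)))))
  }
  where
  rim : ℕ → Fin _
  rim = atℕ (h zero) (λ i → h (suc (suc i)))

  rim≡ : ∀ {a} (a<t : a < t) → rim a ≡ h (suc (suc (fromℕ< a<t)))
  rim≡ = atℕ-fromℕ< (h zero) (λ i → h (suc (suc i)))

  adj-rim : ∀ {a b} → a < t → b < t → adj G (rim a) (rim b) ≡ cycAdj t a b
  adj-rim a<t b<t rewrite rim≡ a<t | rim≡ b<t | h-adj (suc (suc (fromℕ< a<t))) (suc (suc (fromℕ< b<t)))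
    = cong₂ (cycAdj t) (toℕ-fromℕ< a<t) (toℕ-fromℕ< b<t)

  rim-injective : ∀ {a b} → a < t → b < t → rim a ≡ rim b → a ≡ b
  rim-injective {a} {b} a<t b<t e = begin
    a                 ≡⟨ toℕ-fromℕ< a<t ⟨
    toℕ (fromℕ< a<t)  ≡⟨ cong (λ i → pred (pred (toℕ i))) (h-injective (trans (sym (rim≡ a<t)) (trans e (rim≡ b<t)))) ⟩
    toℕ (fromℕ< b<t)  ≡⟨ toℕ-fromℕ< b<t ⟩
    b                 ∎
    where open ≡-Reasoning

InducedCycle-rotate : ∀ {N} {G : Graph N} {t rim} → InducedCycle G t rim → InducedCycle G t (rim ∘ next t)
InducedCycle-rotate C = record
  { adj-rim = λ a<t b<t → trans (adj-rim (next< a<t) (next< b<t)) (cycAdj-rotate a<t b<t)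
  ; rim-injective = λ a<t b<t e → next-injective (rim-injective (next< a<t) (next< b<t) e)
  }
  where open InducedCycle C

InducedCycle-splice : ∀ {N} {G : Graph N} {t c} → 2 ≤ t → c < t → (fill : Slot → Fin N) →
  (∀ {a b} → ValidSlot t c a → ValidSlot t c b → (adj G (fill a) (fill b) ≡ true) ⇔ SlotNeighbours t c a b) →
  (∀ {a b} → ValidSlot t c a → ValidSlot t c b → fill a ≡ fill b → a ≡ b) →
  InducedCycle G (2 + t) (fill ∘ splice c)
InducedCycle-splice {G = G} {t} {c} 2≤t c<t fill fill-adj fill-injective = record
  { adj-rim = adj-rim
  ; rim-injective = λ q< q′< e → splice-injective c (fill-injective (valid q<) (valid q′<) e)
  }
  where
  valid : ∀ {q} → q < 2 + t → ValidSlot t c (splice c q)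
  valid = splice-valid c<t

  next-slot : ∀ {q} → q < 2 + t → splice c (next (2 + t) q) ≡ slotNext t c (splice c q)
  next-slot = splice-next 2≤t c<t

  adj-rim : ∀ {q q′} → q < 2 + t → q′ < 2 + t → adj G (fill (splice c q)) (fill (splice c q′)) ≡ cycAdj (2 + t) q q′
  adj-rim {q} {q′} q< q′< = ≡-by-⇔true to from
    where
    to : adj G (fill (splice c q)) (fill (splice c q′)) ≡ true → cycAdj (2 + t) q q′ ≡ true
    to e with Equivalence.to (fill-adj (valid q<) (valid q′<)) e
    ... | inj₁ x = CycleNeighbours⇒cycAdj (inj₁ (splice-injective c (trans x (sym (next-slot q<)))))
    ... | inj₂ x = CycleNeighbours⇒cycAdj (inj₂ (splice-injective c (trans x (sym (next-slot q′<)))))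
    from : cycAdj (2 + t) q q′ ≡ true → adj G (fill (splice c q)) (fill (splice c q′)) ≡ true
    from e with cycAdj⇒CycleNeighbours q< q′< e
    ... | inj₁ x = Equivalence.from (fill-adj (valid q<) (valid q′<)) (inj₁ (trans (cong (splice c) x) (next-slot q<)))
    ... | inj₂ x = Equivalence.from (fill-adj (valid q<) (valid q′<)) (inj₂ (trans (cong (splice c) x) (next-slot q′<)))

inA : Fin 5 → Bool
inA k = toℕ k <ᵇ 2

k23-degree : ∀ k → ∑[ k′ < 5 ] 𝟙 (k23Adj k k′) ≡ (if inA k then 3 else 2)
k23-degree 0F = refl
k23-degree 1F = refl
k23-degree 2F = refl
k23-degree 3F = refl
k23-degree 4F = refl

k23-independent-count : (x : Fin 5 → Bool) → (∀ {a b} → x a ≡ true → x b ≡ true → k23Adj a b ≡ false) →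
  ∑[ k < 5 ] 𝟙 (x k) ≤ 𝟙 (x 2F ∧ x 3F ∧ x 4F) + 2
k23-independent-count x independent with x 0F in e₀ | x 1F in e₁ | x 2F in e₂ | x 3F in e₃ | x 4F in e₄
... | true | _ | true | _ | _ = ⊥-elim (true≢false (independent e₀ e₂))
... | true | _ | _ | true | _ = ⊥-elim (true≢false (independent e₀ e₃))
... | true | _ | _ | _ | true = ⊥-elim (true≢false (independent e₀ e₄))
... | _ | true | true | _ | _ = ⊥-elim (true≢false (independent e₁ e₂))
... | _ | true | _ | true | _ = ⊥-elim (true≢false (independent e₁ e₃))
... | _ | true | _ | _ | true = ⊥-elim (true≢false (independent e₁ e₄))
... | true | true | false | false | false = ≤ᵇ⇒≤ _ _ _
... | true | false | false | false | false = ≤ᵇ⇒≤ _ _ _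
... | false | true | false | false | false = ≤ᵇ⇒≤ _ _ _
... | false | false | true | true | true = ≤ᵇ⇒≤ _ _ _
... | false | false | true | true | false = ≤ᵇ⇒≤ _ _ _
... | false | false | true | false | true = ≤ᵇ⇒≤ _ _ _
... | false | false | true | false | false = ≤ᵇ⇒≤ _ _ _
... | false | false | false | true | true = ≤ᵇ⇒≤ _ _ _
... | false | false | false | true | false = ≤ᵇ⇒≤ _ _ _
... | false | false | false | false | true = ≤ᵇ⇒≤ _ _ _
... | false | false | false | false | false = ≤ᵇ⇒≤ _ _ _

-- Contracting K to z

module Contraction {n m : ℕ} (G : Graph n) (f : Fin 5 → Fin n) (H : Graph (suc m)) (g : Fin m → Fin n)
    (subcubic : Subcubic G) (K23 : InducesK23 G f)
    (g-injective : ∀ i j → g i ≡ g j → i ≡ j)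
    (g∉K : ∀ i k → g i ≢ f k)
    (cover : ∀ v → (∃ λ k → f k ≡ v) ⊎ (∃ λ i → g i ≡ v))
    (adj-H : ∀ i j → adj H (suc i) (suc j) ≡ adj G (g i) (g j))
    (adj-z : ∀ i → (adj H zero (suc i) ≡ true) ⇔ (∃ λ k → adj G (g i) (f k) ≡ true)) where

  f-injective : ∀ a b → f a ≡ f b → a ≡ b
  f-injective a b = proj₁ K23

  adj-K : ∀ k k′ → adj G (f k) (f k′) ≡ k23Adj k k′
  adj-K = proj₂ K23

  open Partition f g f-injective g-injective g∉K cover

  outdegree : Fin 5 → ℕ
  outdegree k = ∑[ i < m ] 𝟙 (adj G (f k) (g i))

  degree-K : ∀ k → degree G (f k) ≡ (if inA k then 3 else 2) + outdegree k
  degree-K k = begin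
    degree G (f k)                                       ≡⟨ degree≡∑ G (f k) ⟩
    ∑[ v < n ] 𝟙 (adj G (f k) v)                         ≡⟨ sum-partition _ ⟩
    ∑[ k′ < 5 ] 𝟙 (adj G (f k) (f k′)) + outdegree k     ≡⟨ cong (_+ outdegree k) (sum-cong-≗ (cong 𝟙 ∘ adj-K k)) ⟩
    ∑[ k′ < 5 ] 𝟙 (k23Adj k k′) + outdegree k            ≡⟨ cong (_+ outdegree k) (k23-degree k) ⟩
    (if inA k then 3 else 2) + outdegree k               ∎
    where open ≡-Reasoning

  outdegree≤ : ∀ k → outdegree k ≤ (if inA k then 0 else 1)
  outdegree≤ k with inA k | degree-K k
  ... | true | e = +-cancelˡ-≤ 3 _ _ (subst (_≤ 3) e (subcubic (f k)))
  ... | false | e = +-cancelˡ-≤ 2 _ _ (subst (_≤ 3) e (subcubic (f k)))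

  A-nonadj-outside : ∀ {k} i → inA k ≡ true → adj G (f k) (g i) ≡ false
  A-nonadj-outside {k} i k∈A = 𝟙≡0⇒≡false (sum≤0⇒≡0 _ outdegree≤0 i)
    where
    outdegree≤0 : outdegree k ≤ 0
    outdegree≤0 = subst (λ b → outdegree k ≤ (if b then 0 else 1)) k∈A (outdegree≤ k)

  outdegree≤1 : ∀ k → outdegree k ≤ 1
  outdegree≤1 k with inA k | outdegree≤ k
  ... | true | le = m≤n⇒m≤1+n le
  ... | false | le = le

  outside-neighbour-unique : ∀ {k i i′} → adj G (f k) (g i) ≡ true → adj G (f k) (g i′) ≡ true → i ≡ i′
  outside-neighbour-unique {k} {i} {i′} e e′ with i ≟ᶠ i′
  ... | yes i≡i′ = i≡i′
  ... | no i≢i′ = ⊥-elim (1+n≰n (≤-trans two≤outdegree (outdegree≤1 k)))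
    where
    two≤outdegree : 2 ≤ outdegree k
    two≤outdegree = subst₂ (λ a b → 𝟙 a + 𝟙 b ≤ outdegree k) e e′ (two-terms≤sum _ i≢i′)

  B-adj-0F : ∀ {k} → inA k ≡ false → adj G (f 0F) (f k) ≡ true
  B-adj-0F {k} k∉A rewrite adj-K 0F k | k∉A = refl

  B-B-nonadj : ∀ {k k′} → inA k ≡ false → inA k′ ≡ false → adj G (f k) (f k′) ≡ false
  B-B-nonadj {k} {k′} k∉A k′∉A rewrite adj-K k k′ | k∉A | k′∉A = refl

  z-nonadj : ∀ {i} k → adj H zero (suc i) ≡ false → adj G (g i) (f k) ≡ false
  z-nonadj {i} k nonadj = ¬true⇒≡false (λ e → true≢false (trans (sym (Equivalence.from (adj-z i) (k , e))) nonadj))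

  -- The vertex of G that a vertex of H other than z stands for; orig zero is junk.
  orig : Fin (suc m) → Fin n
  orig zero = f 0F
  orig (suc i) = g i

  record KNeighbour (x : Fin (suc m)) : Set where
    field
      k : Fin 5
      k∉A : inA k ≡ false
      adjacent : adj G (orig x) (f k) ≡ true

  z-neighbour : ∀ {x} → adj H zero x ≡ true → KNeighbour x
  z-neighbour {zero} e = ⊥-elim (true≢false (trans (sym e) (irrefl H zero)))
  z-neighbour {suc i} e with Equivalence.to (adj-z i) e
  ... | k , gi~fk with inA k in side-k
  ...   | true = ⊥-elim (true≢false (trans (sym gi~fk) (trans (Graph.sym G _ _) (A-nonadj-outside i side-k))))
  ...   | false = record { k = k ; k∉A = side-k ; adjacent = gi~fk }

  side : Bool → Fin 5 → Bool
  side b k = if b then not (inA k) else inA k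

  module Expand (S′ : Subset (suc m)) (S′-independent : IsIndependent H S′) where

    z∈ : Bool
    z∈ = lookup S′ zero

    χ : Fin n → Bool
    χ = glue (side z∈) (λ i → lookup S′ (suc i))

    size : ∣ tabulate χ ∣ ≡ ∣ S′ ∣ + 2
    size = begin
      ∣ tabulate χ ∣                                   ≡⟨ ∣tabulate∣≡∑ χ ⟩
      ∑[ v < n ] 𝟙 (χ v)                              ≡⟨ sum-partition (𝟙 ∘ χ) ⟩
      ∑[ k < 5 ] 𝟙 (χ (f k)) + ∑[ i < m ] 𝟙 (χ (g i)) ≡⟨ cong₂ _+_ (sum-cong-≗ (cong 𝟙 ∘ glue-f _ _))
                                                                   (sum-cong-≗ (cong 𝟙 ∘ glue-g _ _)) ⟩
      ∑[ k < 5 ] 𝟙 (side z∈ k) + rest                 ≡⟨ cong (_+ rest) (side-size z∈) ⟩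
      𝟙 z∈ + 2 + rest                                 ≡⟨ xy∙z≈xz∙y (𝟙 z∈) 2 rest ⟩
      𝟙 z∈ + rest + 2                                 ≡⟨ cong (_+ 2) (∣S∣≡∑ S′) ⟨
      ∣ S′ ∣ + 2                                      ∎
      where
      open ≡-Reasoning
      rest : ℕ
      rest = ∑[ i < m ] 𝟙 (lookup S′ (suc i))
      side-size : ∀ b → ∑[ k < 5 ] 𝟙 (side b k) ≡ 𝟙 b + 2
      side-size true = refl
      side-size false = refl

    S′-nonadj : ∀ {x y} → lookup S′ x ≡ true → lookup S′ y ≡ true → adj H x y ≡ false
    S′-nonadj = IsIndependent-lookup {G = H} {S′} S′-independent

    χ-f : ∀ k → χ (f k) ≡ side z∈ k
    χ-f = glue-f _ _

    χ-g : ∀ i → χ (g i) ≡ lookup S′ (suc i)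
    χ-g = glue-g _ _

    side-independent : ∀ b {k k′} → side b k ≡ true → side b k′ ≡ true → k23Adj k k′ ≡ false
    side-independent b {k} {k′} with b | inA k | inA k′
    ... | true | false | false = λ _ _ → refl
    ... | false | true | true = λ _ _ → refl
    ... | true | true | _ = λ ()
    ... | true | false | true = λ _ ()
    ... | false | false | _ = λ ()
    ... | false | true | false = λ _ ()

    side-S′ : ∀ {k} i → side z∈ k ≡ true → lookup S′ (suc i) ≡ true → adj G (f k) (g i) ≡ false
    side-S′ {k} i k∈ i∈ with z∈ in z∈≡
    ... | false = A-nonadj-outside i k∈
    ... | true = trans (Graph.sym G _ _) (z-nonadj k (S′-nonadj z∈≡ i∈))

    independent : IsIndependent G (tabulate χ)
    independent = IsIndependent-tabulate G χ (λ {u} {v} → pairs u v)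
      where
      pairs : ∀ u v → χ u ≡ true → χ v ≡ true → adj G u v ≡ false
      pairs = partition-elim
        (λ k → partition-elim
          (λ k′ p q → trans (adj-K k k′) (side-independent z∈ {k} {k′} (trans (sym (χ-f k)) p) (trans (sym (χ-f k′)) q)))
          (λ i p q → side-S′ i (trans (sym (χ-f k)) p) (trans (sym (χ-g i)) q)))
        (λ i → partition-elim
          (λ k p q → trans (Graph.sym G _ _) (side-S′ i (trans (sym (χ-f k)) q) (trans (sym (χ-g i)) p)))
          (λ j p q → trans (sym (adj-H i j)) (S′-nonadj (trans (sym (χ-g i)) p) (trans (sym (χ-g j)) q))))

  module Contract (I : Subset n) (I-independent : IsIndependent G I) where

    I-nonadj : ∀ {u v} → lookup I u ≡ true → lookup I v ≡ true → adj G u v ≡ false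
    I-nonadj = IsIndependent-lookup {G = G} {I} I-independent

    x : Fin 5 → Bool
    x k = lookup I (f k)

    B⊆I : Bool
    B⊆I = x 2F ∧ x 3F ∧ x 4F

    χ : Fin (suc m) → Bool
    χ zero = B⊆I
    χ (suc i) = lookup I (g i)

    size : ∣ I ∣ ≤ ∣ tabulate χ ∣ + 2
    size = begin
      ∣ I ∣                                          ≡⟨ trans (∣S∣≡∑ I) (sum-partition _) ⟩
      ∑[ k < 5 ] 𝟙 (x k) + ∑[ i < m ] 𝟙 (χ (suc i))   ≤⟨ +-monoˡ-≤ _ (k23-independent-count x K-nonadj) ⟩
      𝟙 B⊆I + 2 + ∑[ i < m ] 𝟙 (χ (suc i))            ≡⟨ xy∙z≈xz∙y (𝟙 B⊆I) 2 _ ⟩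
      ∑[ v < suc m ] 𝟙 (χ v) + 2                      ≡⟨ cong (_+ 2) (∣tabulate∣≡∑ χ) ⟨
      ∣ tabulate χ ∣ + 2                              ∎
      where
      open ≤-Reasoning
      K-nonadj : ∀ {a b} → x a ≡ true → x b ≡ true → k23Adj a b ≡ false
      K-nonadj {a} {b} p q = trans (sym (adj-K a b)) (I-nonadj p q)

    B⊆I⇒ : ∀ {k} → B⊆I ≡ true → inA k ≡ false → x k ≡ true
    B⊆I⇒ {2F} e _ = proj₁ (∧-true⁻ e)
    B⊆I⇒ {3F} e _ = proj₁ (∧-true⁻ (proj₂ (∧-true⁻ {x 2F} e)))
    B⊆I⇒ {4F} e _ = proj₂ (∧-true⁻ (proj₂ (∧-true⁻ {x 2F} e)))

    z-free : ∀ {i} → B⊆I ≡ true → lookup I (g i) ≡ true → adj H zero (suc i) ≡ false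
    z-free {i} B⊆I≡ i∈ = ¬true⇒≡false λ e → let open KNeighbour (z-neighbour e) in
      true≢false (trans (sym adjacent) (I-nonadj i∈ (B⊆I⇒ B⊆I≡ k∉A)))

    independent : IsIndependent H (tabulate χ)
    independent = IsIndependent-tabulate H χ (λ {u} {v} → pairs u v)
      where
      pairs : ∀ u v → χ u ≡ true → χ v ≡ true → adj H u v ≡ false
      pairs zero zero _ _ = irrefl H zero
      pairs zero (suc j) p q = z-free p q
      pairs (suc i) zero p q = trans (Graph.sym H _ _) (z-free q p)
      pairs (suc i) (suc j) p q = trans (adj-H i j) (I-nonadj p q)

  independence-number : ∀ a → IsIndependenceNumber G a → IsIndependenceNumber H (a ∸ 2)
  independence-number a ((I , I-independent , ∣I∣≡a) , maximal) =
    (tabulate χ , independent , ≤-antisym (upper (tabulate χ) independent) lower) , upper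
    where
    open Contract I I-independent
    upper : ∀ S′ → IsIndependent H S′ → ∣ S′ ∣ ≤ a ∸ 2
    upper S′ S′-independent = m+n≤o⇒m≤o∸n _ (subst (_≤ a) (Expand.size S′ S′-independent)
                                                 (maximal _ (Expand.independent S′ S′-independent)))
    lower : a ∸ 2 ≤ ∣ tabulate χ ∣
    lower = m≤n+o⇒m∸n≤o a 2 (subst₂ _≤_ ∣I∣≡a (+-comm _ 2) size)

  orig-adj : ∀ {x y} → x ≢ zero → y ≢ zero → adj G (orig x) (orig y) ≡ adj H x y
  orig-adj {zero} x≢z _ = ⊥-elim (x≢z refl)
  orig-adj {suc _} {zero} _ y≢z = ⊥-elim (y≢z refl)
  orig-adj {suc i} {suc j} _ _ = sym (adj-H i j)

  orig-injective : ∀ {x y} → x ≢ zero → y ≢ zero → orig x ≡ orig y → x ≡ y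
  orig-injective {zero} x≢z _ = ⊥-elim (x≢z refl)
  orig-injective {suc _} {zero} _ y≢z = ⊥-elim (y≢z refl)
  orig-injective {suc i} {suc j} _ _ = cong suc ∘ g-injective i j

  orig∉K : ∀ {x k} → x ≢ zero → orig x ≢ f k
  orig∉K {zero} x≢z = ⊥-elim (x≢z refl)
  orig∉K {suc i} {k} _ = g∉K i k

  orig-A : ∀ {x k} → x ≢ zero → inA k ≡ true → adj G (orig x) (f k) ≡ false
  orig-A {zero} x≢z _ = ⊥-elim (x≢z refl)
  orig-A {suc i} _ k∈A = trans (Graph.sym G _ _) (A-nonadj-outside i k∈A)

  orig-z-nonadj : ∀ {x k} → x ≢ zero → adj H zero x ≡ false → adj G (orig x) (f k) ≡ false
  orig-z-nonadj {zero} x≢z _ = ⊥-elim (x≢z refl)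
  orig-z-nonadj {suc i} {k} _ = z-nonadj k

  orig-unique : ∀ {x y k} → x ≢ zero → y ≢ zero → adj G (orig x) (f k) ≡ true → adj G (orig y) (f k) ≡ true → x ≡ y
  orig-unique {zero} x≢z _ _ _ = ⊥-elim (x≢z refl)
  orig-unique {suc _} {zero} _ y≢z _ _ = ⊥-elim (y≢z refl)
  orig-unique {suc i} {suc j} _ _ e e′ = cong suc (outside-neighbour-unique (trans (Graph.sym G _ _) e) (trans (Graph.sym G _ _) e′))

  orig-InducedCycle : ∀ {t rim} → InducedCycle H t rim → (∀ {a} → a < t → rim a ≢ zero) → InducedCycle G t (orig ∘ rim)
  orig-InducedCycle C rim≢z = record
    { adj-rim = λ a<t b<t → trans (orig-adj (rim≢z a<t) (rim≢z b<t)) (adj-rim a<t b<t)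
    ; rim-injective = λ a<t b<t → rim-injective a<t b<t ∘ orig-injective (rim≢z a<t) (rim≢z b<t)
    }
    where open InducedCycle C

  module AppleOfH {p} (4≤p : 4 ≤ p) (A : Apple H p) where
    open Apple A

    3≤p : 3 ≤ p
    3≤p = ≤-trans (n≤1+n 3) 4≤p

    2≤p : 2 ≤ p
    2≤p = ≤-trans (n≤1+n 2) 3≤p

    avoiding-z : end ≢ zero → stem ≢ zero → (∀ {a} → a < p → rim a ≢ zero) → Apple G p
    avoiding-z end≢z stem≢z rim≢z = record
      { end = orig end
      ; stem = orig stem
      ; rim = orig ∘ rim
      ; cycle = orig-InducedCycle cycle rim≢z
      ; end-stem = trans (orig-adj end≢z stem≢z) end-stem
      ; end-rim = λ a<p → trans (orig-adj end≢z (rim≢z a<p)) (end-rim a<p)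
      ; stem-rim = λ a<p → trans (orig-adj stem≢z (rim≢z a<p)) (stem-rim a<p)
      ; end≢stem = end≢stem ∘ orig-injective end≢z stem≢z
      ; end∉rim = λ a<p → end∉rim a<p ∘ orig-injective end≢z (rim≢z a<p)
      ; stem∉rim = λ a<p → stem∉rim a<p ∘ orig-injective stem≢z (rim≢z a<p)
      }

    module EndIsZ (end≡z : end ≡ zero) where

      stem≢z : stem ≢ zero
      stem≢z e = end≢stem (trans end≡z (sym e))

      rim≢z : ∀ {a} → a < p → rim a ≢ zero
      rim≢z a<p e = end∉rim a<p (trans end≡z (sym e))

      open KNeighbour (z-neighbour (subst (λ v → adj H v stem ≡ true) end≡z end-stem))

      apple : Apple G p
      apple = record
        { end = f k
        ; stem = orig stem
        ; rim = orig ∘ rim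
        ; cycle = orig-InducedCycle cycle rim≢z
        ; end-stem = trans (Graph.sym G _ _) adjacent
        ; end-rim = λ {a} a<p → trans (Graph.sym G _ _)
            (orig-z-nonadj (rim≢z a<p) (subst (λ v → adj H v (rim a) ≡ false) end≡z (end-rim a<p)))
        ; stem-rim = λ a<p → trans (orig-adj stem≢z (rim≢z a<p)) (stem-rim a<p)
        ; end≢stem = orig∉K stem≢z ∘ sym
        ; end∉rim = λ a<p → orig∉K (rim≢z a<p) ∘ sym
        ; stem∉rim = λ a<p → stem∉rim a<p ∘ orig-injective stem≢z (rim≢z a<p)
        }

    module StemIsZ (stem≡z : stem ≡ zero) where

      end≢z : end ≢ zero
      end≢z e = end≢stem (trans e (sym stem≡z))

      rim≢z : ∀ {a} → a < p → rim a ≢ zero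
      rim≢z a<p e = stem∉rim a<p (trans stem≡z (sym e))

      0<p : 0 < p
      0<p = ≤-trans (s≤s z≤n) 2≤p

      open KNeighbour (z-neighbour (subst (λ v → adj H v (rim 0) ≡ true) stem≡z (stem-rim 0<p)))

      k≢0F : k ≢ 0F
      k≢0F e = true≢false (trans (sym (cong inA e)) k∉A)

      k-rim : ∀ {a} → a < p → adj G (f k) (orig (rim a)) ≡ (a ≡ᵇ 0)
      k-rim {a} a<p = ≡-by-⇔true
        (λ e → ≡⇒≡ᵇ-true (rim-injective a<p 0<p
          (orig-unique (rim≢z a<p) (rim≢z 0<p) (trans (Graph.sym G _ _) e) adjacent)))
        (λ e → trans (Graph.sym G _ _) (subst (λ b → adj G (orig (rim b)) (f k) ≡ true) (sym (≡ᵇ-true⇒≡ e)) adjacent))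

      apple : Apple G p
      apple = record
        { end = f 0F
        ; stem = f k
        ; rim = orig ∘ rim
        ; cycle = orig-InducedCycle cycle rim≢z
        ; end-stem = B-adj-0F k∉A
        ; end-rim = λ a<p → trans (Graph.sym G _ _) (orig-A (rim≢z a<p) refl)
        ; stem-rim = k-rim
        ; end≢stem = k≢0F ∘ sym ∘ f-injective _ _
        ; end∉rim = λ a<p → orig∉K (rim≢z a<p) ∘ sym
        ; stem∉rim = λ a<p → orig∉K (rim≢z a<p) ∘ sym
        }

    module RimIsZ {c} (c<p : c < p) (rim-c≡z : rim c ≡ zero) where

      end≢z : end ≢ zero
      end≢z e = end∉rim c<p (trans e (sym rim-c≡z))

      stem≢z : stem ≢ zero
      stem≢z e = stem∉rim c<p (trans e (sym rim-c≡z))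

      rim≢z : ∀ {r} → r < p → r ≢ c → rim r ≢ zero
      rim≢z r<p r≢c e = r≢c (rim-injective r<p c<p (trans e (sym rim-c≡z)))

      z-rim : ∀ {r} → r < p → CycleNeighbours p c r → adj H zero (rim r) ≡ true
      z-rim {r} r<p n = subst (λ v → adj H v (rim r) ≡ true) rim-c≡z
        (trans (adj-rim c<p r<p) (CycleNeighbours⇒cycAdj n))

      pr nt : ℕ
      pr = prev p c
      nt = next p c

      pr<p : pr < p
      pr<p = prev< c<p

      nt<p : nt < p
      nt<p = next< c<p

      pr≢c : pr ≢ c
      pr≢c e = next≢ 2≤p c<p (trans (cong (next p) (sym e)) (next-prev c<p))

      nt≢c : nt ≢ c
      nt≢c = next≢ 2≤p c<p

      open KNeighbour (z-neighbour (z-rim pr<p (inj₂ (sym (next-prev c<p)))))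
        renaming (k to kl; k∉A to kl∉A; adjacent to pr~kl)
      open KNeighbour (z-neighbour (z-rim nt<p (inj₁ refl)))
        renaming (k to kr; k∉A to kr∉A; adjacent to nt~kr)

      fill : Slot → Fin n
      fill (old r) = orig (rim r)
      fill left = f kl
      fill apex = f 0F
      fill right = f kr

      Valid : Slot → Set
      Valid = ValidSlot p c

      old≢z : ∀ {r} → Valid (old r) → rim r ≢ zero
      old≢z (r<p , r≢c) = rim≢z r<p r≢c

      old-unique : ∀ {r r′ k} → Valid (old r) → Valid (old r′) →
        adj G (fill (old r)) (f k) ≡ true → adj G (fill (old r′)) (f k) ≡ true → r ≡ r′
      old-unique vr@(r<p , _) vr′@(r′<p , _) e e′ = rim-injective r<p r′<p (orig-unique (old≢z vr) (old≢z vr′) e e′)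

      vpr : Valid (old pr)
      vpr = pr<p , pr≢c

      vnt : Valid (old nt)
      vnt = nt<p , nt≢c

      kl≢kr : kl ≢ kr
      kl≢kr e = next²≢ 3≤p pr<p (begin
        next p (next p pr) ≡⟨ cong (next p) (next-prev c<p) ⟩
        nt                 ≡⟨ old-unique vnt vpr nt~kr (subst (λ k → adj G (fill (old pr)) (f k) ≡ true) e pr~kl) ⟩
        pr                 ∎)
        where open ≡-Reasoning

      private
        nonadjacent : ∀ {a b} → adj G (fill a) (fill b) ≡ false → ¬ SlotNeighbours p c a b →
          (adj G (fill a) (fill b) ≡ true) ⇔ SlotNeighbours p c a b
        nonadjacent e ¬n = mk⇔ (λ e′ → ⊥-elim (true≢false (trans (sym e′) e))) (⊥-elim ∘ ¬n)

        flip-⇔ : ∀ {a b} → (adj G (fill a) (fill b) ≡ true) ⇔ SlotNeighbours p c a b →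
          (adj G (fill b) (fill a) ≡ true) ⇔ SlotNeighbours p c b a
        flip-⇔ {a} {b} a⇔b = mk⇔ (Sum.swap ∘ Equivalence.to a⇔b ∘ trans (Graph.sym G (fill a) (fill b)))
                                  (trans (Graph.sym G (fill b) (fill a)) ∘ Equivalence.from a⇔b ∘ Sum.swap)

      fill-adj : ∀ {a b} → Valid a → Valid b → (adj G (fill a) (fill b) ≡ true) ⇔ SlotNeighbours p c a b
      fill-adj {old r} {old r′} va@(r<p , r≢c) vb@(r′<p , r′≢c) = mk⇔
        (λ e → Equivalence.to neighbours (cycAdj⇒CycleNeighbours r<p r′<p (trans (sym old-old) e)))
        (λ n → trans old-old (CycleNeighbours⇒cycAdj (Equivalence.from neighbours n)))
        where
        old-old : adj G (fill (old r)) (fill (old r′)) ≡ cycAdj p r r′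
        old-old = trans (orig-adj (old≢z va) (old≢z vb)) (adj-rim r<p r′<p)
        neighbours = CycleNeighbours⇔SlotNeighbours c<p r≢c r′≢c
      fill-adj {old r} {left} va _ = mk⇔
        (λ e → inj₁ (subst (λ r → left ≡ slotNext p c (old r)) (old-unique vpr va pr~kl e) (sym (slotNext-prev p c))))
        (Sum.[ (λ x → subst (λ r → adj G (fill (old r)) (f kl) ≡ true) (sym (left≡slotNext⇒prev {p} {c} x)) pr~kl) , (λ ()) ])
      fill-adj {old r} {apex} va _ = nonadjacent (orig-A (old≢z va) refl) Sum.[ apex≢slotNext-old {p} {c} , (λ ()) ]
      fill-adj {old r} {right} va _ = mk⇔
        (λ e → inj₂ (cong old (old-unique va vnt e nt~kr)))
        (Sum.[ ⊥-elim ∘ right≢slotNext-old {p} {c}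
             , (λ x → subst (λ r → adj G (fill (old r)) (f kr) ≡ true) (sym (old-injective x)) nt~kr) ])
      fill-adj {left} {old r} _ vb = flip-⇔ (fill-adj vb _)
      fill-adj {apex} {old r} _ vb = flip-⇔ (fill-adj vb _)
      fill-adj {right} {old r} _ vb = flip-⇔ (fill-adj vb _)
      fill-adj {left} {left} _ _ = nonadjacent (irrefl G _) Sum.[ (λ ()) , (λ ()) ]
      fill-adj {left} {apex} _ _ = mk⇔ (λ _ → inj₁ refl) (λ _ → trans (Graph.sym G _ _) (B-adj-0F kl∉A))
      fill-adj {left} {right} _ _ = nonadjacent (B-B-nonadj kl∉A kr∉A) Sum.[ (λ ()) , (λ ()) ]
      fill-adj {apex} {left} _ _ = flip-⇔ (fill-adj {left} {apex} _ _)
      fill-adj {apex} {apex} _ _ = nonadjacent (irrefl G _) Sum.[ (λ ()) , (λ ()) ]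
      fill-adj {apex} {right} _ _ = mk⇔ (λ _ → inj₁ refl) (λ _ → B-adj-0F kr∉A)
      fill-adj {right} {left} _ _ = flip-⇔ (fill-adj {left} {right} _ _)
      fill-adj {right} {apex} _ _ = flip-⇔ (fill-adj {apex} {right} _ _)
      fill-adj {right} {right} _ _ = nonadjacent (irrefl G _) Sum.[ (λ ()) , (λ ()) ]

      B≢0F : ∀ {k} → inA k ≡ false → f k ≢ f 0F
      B≢0F k∉A e = true≢false (trans (sym (cong inA (f-injective _ _ e))) k∉A)

      fill-injective : ∀ {a b} → Valid a → Valid b → fill a ≡ fill b → a ≡ b
      fill-injective {old r} {old r′} va@(r<p , _) vb@(r′<p , _) e =
        cong old (rim-injective r<p r′<p (orig-injective (old≢z va) (old≢z vb) e))
      fill-injective {old r} {left} va _ = ⊥-elim ∘ orig∉K (old≢z va)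
      fill-injective {old r} {apex} va _ = ⊥-elim ∘ orig∉K (old≢z va)
      fill-injective {old r} {right} va _ = ⊥-elim ∘ orig∉K (old≢z va)
      fill-injective {left} {old r} _ vb = ⊥-elim ∘ orig∉K (old≢z vb) ∘ sym
      fill-injective {apex} {old r} _ vb = ⊥-elim ∘ orig∉K (old≢z vb) ∘ sym
      fill-injective {right} {old r} _ vb = ⊥-elim ∘ orig∉K (old≢z vb) ∘ sym
      fill-injective {left} {left} _ _ _ = refl
      fill-injective {left} {apex} _ _ = ⊥-elim ∘ B≢0F kl∉A
      fill-injective {left} {right} _ _ = ⊥-elim ∘ kl≢kr ∘ f-injective _ _
      fill-injective {apex} {left} _ _ = ⊥-elim ∘ B≢0F kl∉A ∘ sym
      fill-injective {apex} {apex} _ _ _ = refl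
      fill-injective {apex} {right} _ _ = ⊥-elim ∘ B≢0F kr∉A ∘ sym
      fill-injective {right} {left} _ _ = ⊥-elim ∘ kl≢kr ∘ sym ∘ f-injective _ _
      fill-injective {right} {apex} _ _ = ⊥-elim ∘ B≢0F kr∉A
      fill-injective {right} {right} _ _ _ = refl

      spliced : InducedCycle G (2 + p) (fill ∘ splice c)
      spliced = InducedCycle-splice 2≤p c<p fill fill-adj fill-injective

      valid : ∀ {q} → q < 2 + p → Valid (splice c q)
      valid = splice-valid c<p

      ∉fill : ∀ {x a} → x ≢ zero → (∀ {r} → r < p → x ≢ rim r) → Valid a → orig x ≢ fill a
      ∉fill {a = old r} x≢z x∉rim va@(r<p , _) = x∉rim r<p ∘ orig-injective x≢z (old≢z va)
      ∉fill {a = left} x≢z _ _ = orig∉K x≢z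
      ∉fill {a = apex} x≢z _ _ = orig∉K x≢z
      ∉fill {a = right} x≢z _ _ = orig∉K x≢z

      module AwayFromStem (c≢0 : c ≢ 0) where

        z-free : ∀ {x} → adj H x (rim c) ≡ false → adj H zero x ≡ false
        z-free {x} e = trans (Graph.sym H zero x) (subst (λ v → adj H x v ≡ false) rim-c≡z e)

        end-fill : ∀ {a} → Valid a → adj G (orig end) (fill a) ≡ false
        end-fill {old r} va@(r<p , _) = trans (orig-adj end≢z (old≢z va)) (end-rim r<p)
        end-fill {left} _ = orig-z-nonadj end≢z (z-free (end-rim c<p))
        end-fill {apex} _ = orig-A end≢z refl
        end-fill {right} _ = orig-z-nonadj end≢z (z-free (end-rim c<p))

        stem-fill : ∀ {a} → Valid a → (adj G (orig stem) (fill a) ≡ true) ⇔ (a ≡ old 0)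
        stem-fill {old r} va@(r<p , _) = mk⇔
          (λ e → cong old (≡ᵇ-true⇒≡ (trans (sym stem-old) e)))
          (λ e → trans stem-old (≡⇒≡ᵇ-true (old-injective e)))
          where
          stem-old : adj G (orig stem) (orig (rim r)) ≡ (r ≡ᵇ 0)
          stem-old = trans (orig-adj stem≢z (old≢z va)) (stem-rim r<p)
        stem-fill {left} _ = mk⇔ (λ e → ⊥-elim (true≢false (trans (sym e) stem-K))) (λ ())
          where stem-K = orig-z-nonadj stem≢z (z-free (trans (stem-rim c<p) (≢⇒≡ᵇ-false c≢0)))
        stem-fill {apex} _ = mk⇔ (λ e → ⊥-elim (true≢false (trans (sym e) (orig-A stem≢z refl)))) (λ ())
        stem-fill {right} _ = mk⇔ (λ e → ⊥-elim (true≢false (trans (sym e) stem-K))) (λ ())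
          where stem-K = orig-z-nonadj stem≢z (z-free (trans (stem-rim c<p) (≢⇒≡ᵇ-false c≢0)))

        splice-0 : splice c 0 ≡ old 0
        splice-0 = splice-below (n≢0⇒n>0 c≢0)

        stem-spliced : ∀ {q} → q < 2 + p → adj G (orig stem) (fill (splice c q)) ≡ (q ≡ᵇ 0)
        stem-spliced q< = ≡-by-⇔true
          (λ e → ≡⇒≡ᵇ-true (splice-injective c (trans (Equivalence.to (stem-fill (valid q<)) e) (sym splice-0))))
          (λ e → Equivalence.from (stem-fill (valid q<)) (trans (cong (splice c) (≡ᵇ-true⇒≡ e)) splice-0))

        apple : Apple G (2 + p)
        apple = record
          { end = orig end
          ; stem = orig stem
          ; rim = fill ∘ splice c
          ; cycle = spliced
          ; end-stem = trans (orig-adj end≢z stem≢z) end-stem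
          ; end-rim = end-fill ∘ valid
          ; stem-rim = stem-spliced
          ; end≢stem = end≢stem ∘ orig-injective end≢z stem≢z
          ; end∉rim = ∉fill end≢z end∉rim ∘ valid
          ; stem∉rim = ∉fill stem≢z stem∉rim ∘ valid
          }

      module AtStemFoot (c≡0 : c ≡ 0) where

        stem~z : adj H zero stem ≡ true
        stem~z = trans (Graph.sym H zero stem)
          (subst (λ v → adj H stem v ≡ true) rim-c≡z (trans (stem-rim c<p) (≡⇒≡ᵇ-true c≡0)))

        open KNeighbour (z-neighbour stem~z) renaming (k to ks; k∉A to ks∉A; adjacent to stem~ks)

        stem-unique : ∀ {r k} → Valid (old r) → adj G (orig stem) (f k) ≡ true → adj G (fill (old r)) (f k) ≡ true → ⊥
        stem-unique va@(r<p , _) e e′ = stem∉rim r<p (orig-unique stem≢z (old≢z va) e e′)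

        stem-fill : ∀ {a} → Valid a → adj G (orig stem) (fill a) ≡ false
        stem-fill {old r} va@(r<p , r≢c) =
          trans (orig-adj stem≢z (old≢z va)) (trans (stem-rim r<p) (≢⇒≡ᵇ-false (r≢c ∘ flip trans (sym c≡0))))
        stem-fill {left} _ = ¬true⇒≡false λ e → stem-unique vpr e pr~kl
        stem-fill {apex} _ = orig-A stem≢z refl
        stem-fill {right} _ = ¬true⇒≡false λ e → stem-unique vnt e nt~kr

        ks-fill : ∀ {a} → Valid a → (adj G (f ks) (fill a) ≡ true) ⇔ (a ≡ apex)
        ks-fill {old r} va = mk⇔ (λ e → ⊥-elim (stem-unique va stem~ks (trans (Graph.sym G _ _) e))) (λ ())
        ks-fill {left} _ = mk⇔ (λ e → ⊥-elim (true≢false (trans (sym e) (B-B-nonadj ks∉A kl∉A)))) (λ ())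
        ks-fill {apex} _ = mk⇔ (λ _ → refl) (λ _ → trans (Graph.sym G _ _) (B-adj-0F ks∉A))
        ks-fill {right} _ = mk⇔ (λ e → ⊥-elim (true≢false (trans (sym e) (B-B-nonadj ks∉A kr∉A)))) (λ ())

        apex-at-next : ∀ {q} → q < 2 + p → (splice c (next (2 + p) q) ≡ apex) ⇔ (q ≡ 0)
        apex-at-next q< = mk⇔
          (λ e → next-injective (trans (splice-injective c (trans e (sym apex-at-1))) (sym next-0)))
          (λ e → trans (cong (splice c ∘ next (2 + p)) e) (trans (cong (splice c) next-0) apex-at-1))
          where
          next-0 : next (2 + p) 0 ≡ 1
          next-0 = next-suc {2 + p} (λ ())
          apex-at-1 : splice c 1 ≡ apex
          apex-at-1 = trans (cong (splice c ∘ suc) (sym c≡0)) (splice-apex c)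

        ks-rotated : ∀ {q} → q < 2 + p → adj G (f ks) (fill (splice c (next (2 + p) q))) ≡ (q ≡ᵇ 0)
        ks-rotated q< = ≡-by-⇔true
          (λ e → ≡⇒≡ᵇ-true (Equivalence.to (apex-at-next q<) (Equivalence.to (ks-fill (valid (next< q<))) e)))
          (λ e → Equivalence.from (ks-fill (valid (next< q<))) (Equivalence.from (apex-at-next q<) (≡ᵇ-true⇒≡ e)))

        ks≢ : ∀ {r k} → Valid (old r) → adj G (fill (old r)) (f k) ≡ true → ks ≢ k
        ks≢ {r} va e ks≡k = stem-unique va stem~ks (subst (λ k → adj G (fill (old r)) (f k) ≡ true) (sym ks≡k) e)

        ks∉fill : ∀ {a} → Valid a → f ks ≢ fill a
        ks∉fill {old r} va = orig∉K (old≢z va) ∘ sym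
        ks∉fill {left} _ = ks≢ vpr pr~kl ∘ f-injective _ _
        ks∉fill {apex} _ = B≢0F ks∉A
        ks∉fill {right} _ = ks≢ vnt nt~kr ∘ f-injective _ _

        apple : Apple G (2 + p)
        apple = record
          { end = orig stem
          ; stem = f ks
          ; rim = fill ∘ splice c ∘ next (2 + p)
          ; cycle = InducedCycle-rotate spliced
          ; end-stem = stem~ks
          ; end-rim = stem-fill ∘ valid ∘ next<
          ; stem-rim = ks-rotated
          ; end≢stem = orig∉K stem≢z
          ; end∉rim = ∉fill stem≢z stem∉rim ∘ valid ∘ next<
          ; stem∉rim = ks∉fill ∘ valid ∘ next<
          }

    same : Apple G p → Σ ℕ λ p′ → p ≤ p′ × HasInducedApple G p′
    same A′ = p , ≤-refl , Apple⇒HasInducedApple 4≤p A′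

    longer : Apple G (2 + p) → Σ ℕ λ p′ → p ≤ p′ × HasInducedApple G p′
    longer A′ = 2 + p , m≤n+m p 2 , Apple⇒HasInducedApple (≤-trans 4≤p (m≤n+m p 2)) A′

    apple-in-G : Σ ℕ λ p′ → p ≤ p′ × HasInducedApple G p′
    apple-in-G with any? (λ (i : Fin p) → rim (toℕ i) ≟ᶠ zero)
    ... | yes (i , rim-i≡z) with toℕ i ≟ 0
    ...   | yes c≡0 = longer (RimIsZ.AtStemFoot.apple (toℕ<n i) rim-i≡z c≡0)
    ...   | no c≢0 = longer (RimIsZ.AwayFromStem.apple (toℕ<n i) rim-i≡z c≢0)
    apple-in-G | no rim≢z with end ≟ᶠ zero | stem ≟ᶠ zero
    ... | yes end≡z | _ = same (EndIsZ.apple end≡z)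
    ... | no _ | yes stem≡z = same (StemIsZ.apple stem≡z)
    ... | no end≢z | no stem≢z = same (avoiding-z end≢z stem≢z rim-a≢z)
      where
      rim-a≢z : ∀ {a} → a < p → rim a ≢ zero
      rim-a≢z a<p e = rim≢z (fromℕ< a<p , trans (cong rim (toℕ-fromℕ< a<p)) e)

  induced-apple : ∀ p → HasInducedApple H p → Σ ℕ λ p′ → p ≤ p′ × HasInducedApple G p′
  induced-apple p A = AppleOfH.apple-in-G (proj₁ A) (HasInducedApple⇒Apple A)

corollary2 : ∀ {n m} (G : Graph n) (f : Fin 5 → Fin n) (H : Graph (suc m)) (g : Fin m → Fin n) →
    Subcubic G →
    InducesK23 G f →
    (∀ i j → g i ≡ g j → i ≡ j) →
    (∀ i k → g i ≢ f k) →
    (∀ v → (∃ λ k → f k ≡ v) ⊎ (∃ λ i → g i ≡ v)) →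
    (∀ i j → adj H (suc i) (suc j) ≡ adj G (g i) (g j)) →
    (∀ i → (adj H zero (suc i) ≡ true) ⇔ (∃ λ k → adj G (g i) (f k) ≡ true)) →
    (∀ a → IsIndependenceNumber G a → IsIndependenceNumber H (a ∸ 2)) ×
    (∀ p → HasInducedApple H p → Σ ℕ λ p' → p ≤ p' × HasInducedApple G p')
corollary2 G f H g subcubic K23 g-injective g∉K cover adj-H adj-z =
  independence-number , induced-apple
  where open Contraction G f H g subcubic K23 g-injective g∉K cover adj-H adj-z
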